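{- Let $n>8$ and let $G$ be a divisible design graph with parameters $(4n,3n-2,3n-6,2n-2,4,n)$ with quotient matrix $R$ of its canonical partition. If $(a,b,c,d)$ is a row of $R$, then the multiset $\{a,b,c,d\}$ equals $\{n-1,n-1,n-1,1\}$.
   Context: A divisible design graph (DDG) with parameters $(v,k,\lambda_1,\lambda_2,m,n)$ is a $k$-regular graph on $v=mn$ vertices whose vertex set can be partitioned into $m$ classes of size $n$ (a canonical partition) such that any two distinct vertices in the same class have exactly $\lambda_1$ common neighbours and any two vertices in different classes have exactly $\lambda_2$ common neighbours. For $\lambda_1\neq\lambda_2$ the canonical partition is equitable: each vertex of class $V_i$ has the same number $r_{ij}$ of neighbours in class $V_j$; $R=(r_{ij})$ is the quotient matrix. -}

module Defs where

open import Data.Nat using (ℕ; zero; suc; _+_)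
open import Data.Bool using (Bool; true; false; _∧_; if_then_else_)
open import Data.Fin using (Fin; zero; suc; _≟_)
open import Data.Product using (_×_)
open import Relation.Nullary.Decidable using (⌊_⌋)
open import Relation.Binary.PropositionalEquality using (_≡_; _≢_)

count : {v : ℕ} → (Fin v → Bool) → ℕ
count {zero}  p = 0
count {suc v} p = (if p zero then 1 else 0) + count (λ i → p (suc i))

record SimpleGraph (v : ℕ) : Set where
  field
    adj       : Fin v → Fin v → Bool
    symmetric : ∀ x y → adj x y ≡ adj y x
    irreflexive : ∀ x → adj x x ≡ false

open SimpleGraph public

degree : {v : ℕ} → SimpleGraph v → Fin v → ℕ
degree G x = count (λ z → adj G x z)

commonNeighbours : {v : ℕ} → SimpleGraph v → Fin v → Fin v → ℕ
commonNeighbours G x y = count (λ z → adj G x z ∧ adj G y z)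

neighboursIn : {v m : ℕ} → SimpleGraph v → (Fin v → Fin m) → Fin v → Fin m → ℕ
neighboursIn G cls x j = count (λ z → adj G x z ∧ ⌊ cls z ≟ j ⌋)

record IsDDG {v : ℕ} (G : SimpleGraph v) (k λ₁ λ₂ m n : ℕ)
             (cls : Fin v → Fin m) : Set where
  field
    vertices   : v ≡ m Data.Nat.* n
    regular    : ∀ x → degree G x ≡ k
    classSize  : ∀ j → count (λ z → ⌊ cls z ≟ j ⌋) ≡ n
    sameClass  : ∀ x y → x ≢ y → cls x ≡ cls y → commonNeighbours G x y ≡ λ₁
    diffClass  : ∀ x y → cls x ≢ cls y → commonNeighbours G x y ≡ λ₂

IsQuotientMatrix : {v m : ℕ} → SimpleGraph v → (Fin v → Fin m) →
                   (Fin m → Fin m → ℕ) → Set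
IsQuotientMatrix G cls R = ∀ x j → neighboursIn G cls x j ≡ R (cls x) j

{-# OPTIONS --safe #-}
-- Fix a vertex x of class i and write r_l = R i l. Counting the edges between two classes shows
-- that R is symmetric; counting the walks of length two from x back into its own class then gives
-- Σ r_l = k and Σ r_l² = k + (n − 1) λ₁, that is Σ r_l = 3n − 2 and Σ r_l² = 3n² − 6n + 4, with
-- 0 ≤ r_l ≤ n. The deficiencies e_l = n − r_l satisfy Σ e_l = n + 2 and Σ e_l² = n² − 2n + 4.
-- If e is the largest of them, Σ e_l² ≤ e · Σ e_l forces the other three to sum to at most 5, and
-- comparing squares leaves only e = n − 1 with the other three deficiencies equal to 1.
module Submission where

open import Defs
open import Data.Bool using (Bool; true; false; _∧_; if_then_else_; T)
open import Data.Bool.Properties using (∧-idem)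
open import Data.Empty using (⊥-elim)
open import Data.Fin using (Fin; zero; suc; _≟_)
open import Data.List using (List; []; _∷_; map; length; replicate; tabulate)
open import Data.List.Properties using (length-map; map-∘; map-id-local)
open import Data.List.Relation.Binary.Permutation.Propositional
  using (_↭_; prep; swap; ↭-refl; ↭-sym; ↭-trans)
open import Data.List.Relation.Binary.Permutation.Propositional.Properties
  using (All-resp-↭; map⁺; ↭-length; shift)
open import Data.List.Relation.Unary.All as All using (All; []; _∷_)
open import Data.List.Relation.Unary.All.Properties as All using ()
open import Data.Nat using (ℕ; zero; suc; _+_; _*_; _∸_; _≤_; _<_; _>_; z≤n; s≤s; NonZero; >-nonZero)
open import Data.Nat.ListAction using (sum)
open import Data.Nat.ListAction.Properties using (sum-↭)
open import Data.Nat.Properties hiding (_≟_)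
open import Data.Nat.Tactic.RingSolver using (solve-∀)
open import Data.Product as Product using (_×_; _,_; proj₁; proj₂; ∃; ∃₂)
open import Data.Sum using (inj₁; inj₂; reduce)
open import Data.Unit using (tt)
open import Function using (_∘_; id)
open import Relation.Binary.PropositionalEquality
  using (_≡_; refl; sym; trans; cong; cong₂; subst; subst₂; module ≡-Reasoning)
open import Relation.Nullary using (yes; no)
open import Relation.Nullary.Decidable using (⌊_⌋; toWitness)
open import Relation.Nullary.Negation using (contradiction)

open import Algebra.Properties.CommutativeSemigroup +-commutativeSemigroup using (interchange)
open import Algebra.Properties.Semiring.Sum +-*-semiring
  using (sum-syntax; ∑-comm; ∑-distrib-+; *-distribˡ-sum; *-distribʳ-sum; sum-cong-≗; sum-replicate-zero)

⟦_⟧ : Bool → ℕ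
⟦ b ⟧ = if b then 1 else 0

⟦∧⟧ : ∀ a b → ⟦ a ∧ b ⟧ ≡ ⟦ a ⟧ * ⟦ b ⟧
⟦∧⟧ true  b = sym (+-identityʳ ⟦ b ⟧)
⟦∧⟧ false b = refl

⟦⟧≤1 : ∀ b → ⟦ b ⟧ ≤ 1
⟦⟧≤1 true  = ≤-refl
⟦⟧≤1 false = z≤n

count≡∑ : ∀ {v} (p : Fin v → Bool) → count p ≡ ∑[ z < v ] ⟦ p z ⟧
count≡∑ {zero}  p = refl
count≡∑ {suc v} p = cong (⟦ p zero ⟧ +_) (count≡∑ (p ∘ suc))

count>0⇒∃ : ∀ {v} (p : Fin v → Bool) → 0 < count p → ∃ λ z → T (p z)
count>0⇒∃ {suc v} p pos with p zero in eq
... | true  = zero , subst T (sym eq) tt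
... | false = Product.map suc id (count>0⇒∃ (p ∘ suc) pos)

∑-mono-≤ : ∀ {v} {f g : Fin v → ℕ} → (∀ z → f z ≤ g z) → ∑[ z < v ] f z ≤ ∑[ z < v ] g z
∑-mono-≤ {zero}  f≤g = z≤n
∑-mono-≤ {suc v} f≤g = +-mono-≤ (f≤g zero) (∑-mono-≤ (f≤g ∘ suc))

-- Not definitional: ⌊_⌋ is stuck on map′ (x ≟ y) until x ≟ y is evaluated.
⌊suc≟suc⌋ : ∀ {v} (x y : Fin v) → ⌊ suc x ≟ suc y ⌋ ≡ ⌊ x ≟ y ⌋
⌊suc≟suc⌋ x y with x ≟ y
... | yes _ = refl
... | no _  = refl

∑-δ : ∀ {v} (x : Fin v) (g : Fin v → ℕ) → ∑[ y < v ] (⟦ ⌊ x ≟ y ⌋ ⟧ * g y) ≡ g x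
∑-δ {suc v} zero    g = trans (cong₂ _+_ (+-identityʳ (g zero)) (sum-replicate-zero v)) (+-identityʳ (g zero))
∑-δ {suc v} (suc x) g =
  trans (sum-cong-≗ (λ y → cong (λ b → ⟦ b ⟧ * g (suc y)) (⌊suc≟suc⌋ x y))) (∑-δ x (g ∘ suc))

∑-transpose : ∀ {u w} (a : Fin u → ℕ) (B : Fin u → Fin w → ℕ) (c : Fin w → ℕ) →
  ∑[ x < u ] (a x * ∑[ y < w ] (B x y * c y)) ≡ ∑[ y < w ] (c y * ∑[ x < u ] (a x * B x y))
∑-transpose {u} {w} a B c = begin
  ∑[ x < u ] (a x * ∑[ y < w ] (B x y * c y))     ≡⟨ sum-cong-≗ (λ x → *-distribˡ-sum (a x) (λ y → B x y * c y)) ⟩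
  ∑[ x < u ] ∑[ y < w ] (a x * (B x y * c y))     ≡⟨ ∑-comm (λ x y → a x * (B x y * c y)) ⟩
  ∑[ y < w ] ∑[ x < u ] (a x * (B x y * c y))     ≡⟨ sum-cong-≗ (λ y → sum-cong-≗ (λ x → rotate (a x) (B x y) (c y))) ⟩
  ∑[ y < w ] ∑[ x < u ] (c y * (a x * B x y))     ≡⟨ sum-cong-≗ (λ y → sym (*-distribˡ-sum (c y) (λ x → a x * B x y))) ⟩
  ∑[ y < w ] (c y * ∑[ x < u ] (a x * B x y))     ∎
  where
  open ≡-Reasoning
  rotate : ∀ a b c → a * (b * c) ≡ c * (a * b)
  rotate = solve-∀

module Quotient {v m : ℕ} (G : SimpleGraph v) (cls : Fin v → Fin m)
             (R : Fin m → Fin m → ℕ) (isQuotient : IsQuotientMatrix G cls R) where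

  A : Fin v → Fin v → ℕ
  A x y = ⟦ adj G x y ⟧

  [_∈_] : Fin v → Fin m → ℕ
  [ z ∈ j ] = ⟦ ⌊ cls z ≟ j ⌋ ⟧

  A-sym : ∀ x y → A x y ≡ A y x
  A-sym x y = cong ⟦_⟧ (symmetric G x y)

  ∑-adj-∈ : ∀ x j → ∑[ z < v ] (A x z * [ z ∈ j ]) ≡ R (cls x) j
  ∑-adj-∈ x j = begin
    ∑[ z < v ] (A x z * [ z ∈ j ])               ≡⟨ sum-cong-≗ (λ z → sym (⟦∧⟧ (adj G x z) _)) ⟩
    ∑[ z < v ] ⟦ adj G x z ∧ ⌊ cls z ≟ j ⌋ ⟧     ≡⟨ count≡∑ (λ z → adj G x z ∧ ⌊ cls z ≟ j ⌋) ⟨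
    neighboursIn G cls x j                       ≡⟨ isQuotient x j ⟩
    R (cls x) j                                  ∎
    where open ≡-Reasoning

  commonNeighbours≡∑ : ∀ x y → commonNeighbours G x y ≡ ∑[ z < v ] (A x z * A z y)
  commonNeighbours≡∑ x y = trans (count≡∑ (λ z → adj G x z ∧ adj G y z))
    (sum-cong-≗ (λ z → trans (⟦∧⟧ (adj G x z) _) (cong (A x z *_) (A-sym y z))))

  ∑-quotientRow≡degree : ∀ x → ∑[ j < m ] R (cls x) j ≡ degree G x
  ∑-quotientRow≡degree x = begin
    ∑[ j < m ] R (cls x) j                        ≡⟨ sum-cong-≗ (sym ∘ ∑-adj-∈ x) ⟩
    ∑[ j < m ] ∑[ z < v ] (A x z * [ z ∈ j ])     ≡⟨ ∑-comm (λ j z → A x z * [ z ∈ j ]) ⟩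
    ∑[ z < v ] ∑[ j < m ] (A x z * [ z ∈ j ])     ≡⟨ sum-cong-≗ (λ z → *-distribˡ-sum (A x z) [ z ∈_]) ⟨
    ∑[ z < v ] (A x z * ∑[ j < m ] [ z ∈ j ])     ≡⟨ sum-cong-≗ (λ z → cong (A x z *_) (in-one-class z)) ⟩
    ∑[ z < v ] (A x z * 1)                        ≡⟨ sum-cong-≗ (λ z → *-identityʳ (A x z)) ⟩
    ∑[ z < v ] A x z                              ≡⟨ count≡∑ (adj G x) ⟨
    degree G x                                    ∎
    where
    open ≡-Reasoning
    in-one-class : ∀ z → ∑[ j < m ] [ z ∈ j ] ≡ 1
    in-one-class z = trans (sum-cong-≗ (λ j → sym (*-identityʳ [ z ∈ j ]))) (∑-δ (cls z) (λ _ → 1))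

  ∑-edgesBetween : ∀ i l → ∑[ x < v ] ([ x ∈ i ] * R (cls x) l) ≡ ∑[ y < v ] ([ y ∈ l ] * R (cls y) i)
  ∑-edgesBetween i l = begin
    ∑[ x < v ] ([ x ∈ i ] * R (cls x) l)                     ≡⟨ sum-cong-≗ (λ x → cong ([ x ∈ i ] *_) (∑-adj-∈ x l)) ⟨
    ∑[ x < v ] ([ x ∈ i ] * ∑[ y < v ] (A x y * [ y ∈ l ]))  ≡⟨ ∑-transpose [_∈ i ] A [_∈ l ] ⟩
    ∑[ y < v ] ([ y ∈ l ] * ∑[ x < v ] ([ x ∈ i ] * A x y))  ≡⟨ sum-cong-≗ (λ y → cong ([ y ∈ l ] *_) (sum-cong-≗ (λ x →
                                                                  trans (*-comm [ x ∈ i ] (A x y)) (cong (_* [ x ∈ i ]) (A-sym x y))))) ⟩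
    ∑[ y < v ] ([ y ∈ l ] * ∑[ x < v ] (A y x * [ x ∈ i ]))  ≡⟨ sum-cong-≗ (λ y → cong ([ y ∈ l ] *_) (∑-adj-∈ y i)) ⟩
    ∑[ y < v ] ([ y ∈ l ] * R (cls y) i)                     ∎
    where open ≡-Reasoning

  ∑-commonNeighbours-inClass : ∀ x i →
    ∑[ y < v ] ([ y ∈ i ] * commonNeighbours G x y) ≡ ∑[ l < m ] (R l i * R (cls x) l)
  ∑-commonNeighbours-inClass x i = begin
    ∑[ y < v ] ([ y ∈ i ] * commonNeighbours G x y)          ≡⟨ sum-cong-≗ (λ y → cong ([ y ∈ i ] *_) (commonNeighbours≡∑ x y)) ⟩
    ∑[ y < v ] ([ y ∈ i ] * ∑[ z < v ] (A x z * A z y))      ≡⟨ ∑-transpose (A x) A [_∈ i ] ⟨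
    ∑[ z < v ] (A x z * ∑[ y < v ] (A z y * [ y ∈ i ]))      ≡⟨ sum-cong-≗ (λ z → cong (A x z *_) (∑-adj-∈ z i)) ⟩
    ∑[ z < v ] (A x z * R (cls z) i)                         ≡⟨ sum-cong-≗ (λ z → cong (A x z *_) (∑-δ (cls z) (λ l → R l i))) ⟨
    ∑[ z < v ] (A x z * ∑[ l < m ] ([ z ∈ l ] * R l i))      ≡⟨ ∑-transpose (A x) [_∈_] (λ l → R l i) ⟩
    ∑[ l < m ] (R l i * ∑[ z < v ] (A x z * [ z ∈ l ]))      ≡⟨ sum-cong-≗ (λ l → cong (R l i *_) (∑-adj-∈ x l)) ⟩
    ∑[ l < m ] (R l i * R (cls x) l)                         ∎
    where open ≡-Reasoning

  module EqualClasses {n : ℕ} (classSize : ∀ j → count (λ z → ⌊ cls z ≟ j ⌋) ≡ n) where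

    ∑-∈-class : ∀ i (f : Fin m → ℕ) → ∑[ x < v ] ([ x ∈ i ] * f (cls x)) ≡ n * f i
    ∑-∈-class i f = begin
      ∑[ x < v ] ([ x ∈ i ] * f (cls x)) ≡⟨ sum-cong-≗ evaluate-at-class ⟩
      ∑[ x < v ] ([ x ∈ i ] * f i)       ≡⟨ *-distribʳ-sum (f i) [_∈ i ] ⟨
      ∑[ x < v ] [ x ∈ i ] * f i         ≡⟨ cong (_* f i) (trans (sym (count≡∑ (λ z → ⌊ cls z ≟ i ⌋))) (classSize i)) ⟩
      n * f i                            ∎
      where
      open ≡-Reasoning
      evaluate-at-class : ∀ x → [ x ∈ i ] * f (cls x) ≡ [ x ∈ i ] * f i
      evaluate-at-class x with cls x ≟ i
      ... | yes refl = refl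
      ... | no _     = refl

    quotient-symmetric : .{{NonZero n}} → ∀ i l → R i l ≡ R l i
    quotient-symmetric i l = *-cancelˡ-≡ (R i l) (R l i) n (begin
      n * R i l                            ≡⟨ ∑-∈-class i (λ j → R j l) ⟨
      ∑[ x < v ] ([ x ∈ i ] * R (cls x) l) ≡⟨ ∑-edgesBetween i l ⟩
      ∑[ y < v ] ([ y ∈ l ] * R (cls y) i) ≡⟨ ∑-∈-class l (λ j → R j i) ⟩
      n * R l i                            ∎)
      where open ≡-Reasoning

    quotient≤classSize : ∀ x j → R (cls x) j ≤ n
    quotient≤classSize x j = begin
      R (cls x) j                   ≡⟨ ∑-adj-∈ x j ⟨
      ∑[ z < v ] (A x z * [ z ∈ j ]) ≤⟨ ∑-mono-≤ (λ z → ≤-trans (*-monoˡ-≤ [ z ∈ j ] (⟦⟧≤1 (adj G x z))) (≤-reflexive (*-identityˡ [ z ∈ j ]))) ⟩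
      ∑[ z < v ] [ z ∈ j ]           ≡⟨ count≡∑ (λ z → ⌊ cls z ≟ j ⌋) ⟨
      count (λ z → ⌊ cls z ≟ j ⌋)    ≡⟨ classSize j ⟩
      n                             ∎
      where open ≤-Reasoning

  module DivisibleDesign {k λ₁ λ₂ n : ℕ} (ddg : IsDDG G k λ₁ λ₂ m n cls) where

    open IsDDG ddg
    open EqualClasses classSize public

    commonNeighbours-self : ∀ x → commonNeighbours G x x ≡ k
    commonNeighbours-self x = begin
      commonNeighbours G x x                  ≡⟨ count≡∑ (λ z → adj G x z ∧ adj G x z) ⟩
      ∑[ z < v ] ⟦ adj G x z ∧ adj G x z ⟧    ≡⟨ sum-cong-≗ (λ z → cong ⟦_⟧ (∧-idem (adj G x z))) ⟩
      ∑[ z < v ] A x z                        ≡⟨ count≡∑ (adj G x) ⟨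
      degree G x                              ≡⟨ regular x ⟩
      k                                       ∎
      where open ≡-Reasoning

    ∑-commonNeighbours-ownClass : ∀ x → ∑[ y < v ] ([ y ∈ cls x ] * commonNeighbours G x y) + λ₁ ≡ n * λ₁ + k
    ∑-commonNeighbours-ownClass x = begin
      ∑[ y < v ] ([ y ∈ cls x ] * commonNeighbours G x y) + λ₁
        ≡⟨ cong (_ +_) (∑-δ x (λ _ → λ₁)) ⟨
      ∑[ y < v ] ([ y ∈ cls x ] * commonNeighbours G x y) + ∑[ y < v ] (δ y * λ₁)
        ≡⟨ ∑-distrib-+ (λ y → [ y ∈ cls x ] * commonNeighbours G x y) (λ y → δ y * λ₁) ⟨
      ∑[ y < v ] ([ y ∈ cls x ] * commonNeighbours G x y + δ y * λ₁)
        ≡⟨ sum-cong-≗ split ⟩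
      ∑[ y < v ] ([ y ∈ cls x ] * λ₁ + δ y * k)
        ≡⟨ ∑-distrib-+ (λ y → [ y ∈ cls x ] * λ₁) (λ y → δ y * k) ⟩
      ∑[ y < v ] ([ y ∈ cls x ] * λ₁) + ∑[ y < v ] (δ y * k)
        ≡⟨ cong₂ _+_ (∑-∈-class (cls x) (λ _ → λ₁)) (∑-δ x (λ _ → k)) ⟩
      n * λ₁ + k ∎
      where
      open ≡-Reasoning
      δ : Fin v → ℕ
      δ y = ⟦ ⌊ x ≟ y ⌋ ⟧
      split : ∀ y → [ y ∈ cls x ] * commonNeighbours G x y + δ y * λ₁ ≡ [ y ∈ cls x ] * λ₁ + δ y * k
      -- ⟦ true ⟧ * t and ⟦ false ⟧ * t reduce to t + 0 and 0.
      split y with x ≟ y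
      split y | yes refl with cls y ≟ cls y
      ... | yes _ = trans (cong (λ c → c + 0 + (λ₁ + 0)) (commonNeighbours-self y)) (+-comm (k + 0) (λ₁ + 0))
      ... | no c≢c = ⊥-elim (c≢c refl)
      split y | no x≢y with cls y ≟ cls x
      ... | yes y∼x = cong (λ c → c + 0 + 0) (sameClass x y x≢y (sym y∼x))
      ... | no _    = refl

    quotientRow-sum : ∀ x → ∑[ l < m ] R (cls x) l ≡ k
    quotientRow-sum x = trans (∑-quotientRow≡degree x) (regular x)

    quotientRow-sumSq : .{{NonZero n}} → ∀ x → ∑[ l < m ] (R (cls x) l * R (cls x) l) + λ₁ ≡ n * λ₁ + k
    quotientRow-sumSq x = begin
      ∑[ l < m ] (R (cls x) l * R (cls x) l) + λ₁          ≡⟨ cong (_+ λ₁) (sum-cong-≗ (λ l → cong (_* R (cls x) l) (quotient-symmetric (cls x) l))) ⟩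
      ∑[ l < m ] (R l (cls x) * R (cls x) l) + λ₁          ≡⟨ cong (_+ λ₁) (∑-commonNeighbours-inClass x (cls x)) ⟨
      ∑[ y < v ] ([ y ∈ cls x ] * commonNeighbours G x y) + λ₁ ≡⟨ ∑-commonNeighbours-ownClass x ⟩
      n * λ₁ + k                                           ∎
      where open ≡-Reasoning

sumSq : List ℕ → ℕ
sumSq xs = sum (map (λ x → x * x) xs)

≤-+-≡⇒≡ : ∀ {a b c d} → a ≤ b → c ≤ d → a + c ≡ b + d → a ≡ b × c ≡ d
≤-+-≡⇒≡ {a} {b} {c} {d} a≤b c≤d eq = a≡b , +-cancelˡ-≡ a c d (trans eq (cong (_+ d) (sym a≡b)))
  where
  a≡b : a ≡ b
  a≡b = ≤-antisym a≤b (+-cancelʳ-≤ d b a (begin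
    b + d ≡⟨ sym eq ⟩
    a + c ≤⟨ +-monoʳ-≤ a c≤d ⟩
    a + d ∎))
    where open ≤-Reasoning

[1+n]*[1+n]+1≡2*[1+n]+n*n : ∀ n → suc n * suc n + 1 ≡ 2 * suc n + n * n
[1+n]*[1+n]+1≡2*[1+n]+n*n = solve-∀

2*n≤n*n+1 : ∀ n → 2 * n ≤ n * n + 1
2*n≤n*n+1 zero    = z≤n
2*n≤n*n+1 (suc n) = ≤-trans (m≤m+n (2 * suc n) (n * n)) (≤-reflexive (sym ([1+n]*[1+n]+1≡2*[1+n]+n*n n)))

2*n≡n*n+1⇒n≡1 : ∀ n → 2 * n ≡ n * n + 1 → n ≡ 1
2*n≡n*n+1⇒n≡1 (suc n) eq = cong suc (reduce (m*n≡0⇒m≡0∨n≡0 n n*n≡0))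
  where
  n*n≡0 : n * n ≡ 0
  n*n≡0 = +-cancelˡ-≡ (2 * suc n) (n * n) 0
    (trans (sym (trans eq ([1+n]*[1+n]+1≡2*[1+n]+n*n n))) (sym (+-identityʳ (2 * suc n))))

m+1+[n+o]≡m+n+[1+o] : ∀ a b c → a + 1 + (b + c) ≡ a + b + suc c
m+1+[n+o]≡m+n+[1+o] = solve-∀

2*sum≤sumSq+length : ∀ xs → 2 * sum xs ≤ sumSq xs + length xs
2*sum≤sumSq+length []       = z≤n
2*sum≤sumSq+length (x ∷ xs) = begin
  2 * (x + sum xs)              ≡⟨ *-distribˡ-+ 2 x (sum xs) ⟩
  2 * x + 2 * sum xs            ≤⟨ +-mono-≤ (2*n≤n*n+1 x) (2*sum≤sumSq+length xs) ⟩
  x * x + 1 + (sumSq xs + length xs) ≡⟨ m+1+[n+o]≡m+n+[1+o] (x * x) (sumSq xs) (length xs) ⟩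
  x * x + sumSq xs + suc (length xs) ∎
  where open ≤-Reasoning

2*sum≡sumSq+length⇒All≡1 : ∀ xs → 2 * sum xs ≡ sumSq xs + length xs → All (_≡ 1) xs
2*sum≡sumSq+length⇒All≡1 []       _  = []
2*sum≡sumSq+length⇒All≡1 (x ∷ xs) eq =
  2*n≡n*n+1⇒n≡1 x (proj₁ split) ∷ 2*sum≡sumSq+length⇒All≡1 xs (proj₂ split)
  where
  split : 2 * x ≡ x * x + 1 × 2 * sum xs ≡ sumSq xs + length xs
  split = ≤-+-≡⇒≡ (2*n≤n*n+1 x) (2*sum≤sumSq+length xs) (begin
    2 * x + 2 * sum xs                 ≡⟨ sym (*-distribˡ-+ 2 x (sum xs)) ⟩
    2 * (x + sum xs)                   ≡⟨ eq ⟩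
    x * x + sumSq xs + suc (length xs) ≡⟨ sym (m+1+[n+o]≡m+n+[1+o] (x * x) (sumSq xs) (length xs)) ⟩
    x * x + 1 + (sumSq xs + length xs) ∎)
    where open ≡-Reasoning

All-≡⇒≡replicate : ∀ {a} {xs : List ℕ} → All (_≡ a) xs → xs ≡ replicate (length xs) a
All-≡⇒≡replicate []           = refl
All-≡⇒≡replicate (refl ∷ xs≡a) = cong (_ ∷_) (All-≡⇒≡replicate xs≡a)

sumSq≤*sum : ∀ {m xs} → All (_≤ m) xs → sumSq xs ≤ m * sum xs
sumSq≤*sum {m} {[]}     []          = z≤n
sumSq≤*sum {m} {x ∷ xs} (x≤m ∷ xs≤m) = begin
  x * x + sumSq xs   ≤⟨ +-mono-≤ (*-monoˡ-≤ x x≤m) (sumSq≤*sum xs≤m) ⟩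
  m * x + m * sum xs ≡⟨ sym (*-distribˡ-+ m x (sum xs)) ⟩
  m * (x + sum xs)   ∎
  where open ≤-Reasoning

sumSq≤sum*sum : ∀ xs → sumSq xs ≤ sum xs * sum xs
sumSq≤sum*sum []       = z≤n
sumSq≤sum*sum (x ∷ xs) = begin
  x * x + sumSq xs                        ≤⟨ +-monoʳ-≤ (x * x) (sumSq≤sum*sum xs) ⟩
  x * x + sum xs * sum xs                 ≤⟨ m≤m+n _ (2 * x * sum xs) ⟩
  x * x + sum xs * sum xs + 2 * x * sum xs ≡⟨ square-expand x (sum xs) ⟩
  (x + sum xs) * (x + sum xs)             ∎
  where
  open ≤-Reasoning
  square-expand : ∀ a b → a * a + b * b + 2 * a * b ≡ (a + b) * (a + b)
  square-expand = solve-∀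

sum-complement : ∀ {n xs} → All (_≤ n) xs → sum xs + sum (map (n ∸_) xs) ≡ length xs * n
sum-complement {n} {[]}     []          = refl
sum-complement {n} {x ∷ xs} (x≤n ∷ xs≤n) = begin
  x + sum xs + (n ∸ x + sum (map (n ∸_) xs))   ≡⟨ interchange x (sum xs) (n ∸ x) _ ⟩
  (x + (n ∸ x)) + (sum xs + sum (map (n ∸_) xs)) ≡⟨ cong₂ _+_ (m+[n∸m]≡n x≤n) (sum-complement xs≤n) ⟩
  n + length xs * n                            ∎
  where open ≡-Reasoning

sumSq-complement : ∀ {n xs} → All (_≤ n) xs →
  sumSq (map (n ∸_) xs) + n * sum xs ≡ n * sum (map (n ∸_) xs) + sumSq xs
sumSq-complement {n} {[]}     []          = sym (+-identityʳ (n * 0))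
sumSq-complement {n} {x ∷ xs} (x≤n ∷ xs≤n) = begin
  (e * e + sumSq es) + n * (x + sum xs)   ≡⟨ regroup₁ (e * e) (sumSq es) n x (sum xs) ⟩
  (e * e + n * x) + (sumSq es + n * sum xs) ≡⟨ cong₂ _+_ square-complement (sumSq-complement xs≤n) ⟩
  (n * e + x * x) + (n * sum es + sumSq xs) ≡⟨ regroup₂ n e (x * x) (sum es) (sumSq xs) ⟩
  n * (e + sum es) + (x * x + sumSq xs)   ∎
  where
  open ≡-Reasoning
  e = n ∸ x
  es = map (n ∸_) xs
  square-complement : e * e + n * x ≡ n * e + x * x
  square-complement = subst (λ n′ → e * e + n′ * x ≡ n′ * e + x * x) (m+[n∸m]≡n x≤n) (complement-square x e)
    where
    complement-square : ∀ x e → e * e + (x + e) * x ≡ (x + e) * e + x * x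
    complement-square = solve-∀
  regroup₁ : ∀ a b n c d → (a + b) + n * (c + d) ≡ (a + n * c) + (b + n * d)
  regroup₁ = solve-∀
  regroup₂ : ∀ n e a s b → (n * e + a) + (n * s + b) ≡ n * (e + s) + (a + b)
  regroup₂ = solve-∀

m+[2+u]≡n+2⇒n≡m+u : ∀ m u n → m + (2 + u) ≡ n + 2 → n ≡ m + u
m+[2+u]≡n+2⇒n≡m+u m u n eq = +-cancelʳ-≡ 2 n (m + u) (trans (sym eq) (reassociate m u))
  where
  reassociate : ∀ m u → m + (2 + u) ≡ m + u + 2
  reassociate = solve-∀

tail-sumSq-formula : ∀ m u q → m * m + q + 2 * (m + suc u) ≡ (m + suc u) * (m + suc u) + 4 →
                  q ≡ 2 * u * m + u * u + 3
tail-sumSq-formula m u q eq = +-cancelˡ-≡ (m * m + 2 * m + 2 * u + 2) q (2 * u * m + u * u + 3) (begin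
  m * m + 2 * m + 2 * u + 2 + q                  ≡⟨ expand-left m u q ⟩
  m * m + q + 2 * (m + suc u)                    ≡⟨ eq ⟩
  (m + suc u) * (m + suc u) + 4                  ≡⟨ expand-right m u ⟩
  m * m + 2 * m + 2 * u + 2 + (2 * u * m + u * u + 3) ∎)
  where
  open ≡-Reasoning
  expand-left : ∀ m u q → m * m + 2 * m + 2 * u + 2 + q ≡ m * m + q + 2 * (m + suc u)
  expand-left = solve-∀
  expand-right : ∀ m u → (m + suc u) * (m + suc u) + 4 ≡ m * m + 2 * m + 2 * u + 2 + (2 * u * m + u * u + 3)
  expand-right = solve-∀

tail-sum≤5 : ∀ {n m s q} → m + s ≡ n + 2 → m * m + q + 2 * n ≡ n * n + 4 → q ≤ m * s → s ≤ 5
tail-sum≤5 {n} {m} {s} {q} sumEq sqEq q≤ms = ≮⇒≥ λ 5<s → m+1+n≰m (n * n + 4 * n) (begin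
  n * n + 4 * n + 12                 ≡⟨ regroup₁ n ⟩
  (n * n + 4) + (4 * n + 8)          ≡⟨ cong (_+ (4 * n + 8)) (sym sqEq) ⟩
  m * m + q + 2 * n + (4 * n + 8)    ≤⟨ +-monoˡ-≤ (4 * n + 8) (+-monoˡ-≤ (2 * n) (+-monoʳ-≤ (m * m) q≤ms)) ⟩
  m * m + m * s + 2 * n + (4 * n + 8) ≡⟨ regroup₂ m s n ⟩
  m * (m + s) + 2 * n + (4 * n + 8)  ≡⟨ cong (λ t → m * t + 2 * n + (4 * n + 8)) sumEq ⟩
  m * (n + 2) + 2 * n + (4 * n + 8)  ≡⟨ regroup₃ m n ⟩
  (m + 4) * (n + 2) + 2 * n          ≤⟨ +-monoˡ-≤ (2 * n) (*-monoˡ-≤ (n + 2) (m+4≤n 5<s)) ⟩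
  n * (n + 2) + 2 * n                ≡⟨ regroup₄ n ⟩
  n * n + 4 * n                      ∎)
  where
  open ≤-Reasoning
  m+4≤n : 5 < s → m + 4 ≤ n
  m+4≤n 6≤s = +-cancelʳ-≤ 2 (m + 4) n (begin
    m + 4 + 2 ≡⟨ +-assoc m 4 2 ⟩
    m + 6     ≤⟨ +-monoʳ-≤ m 6≤s ⟩
    m + s     ≡⟨ sumEq ⟩
    n + 2     ∎)
  regroup₁ : ∀ n → n * n + 4 * n + 12 ≡ (n * n + 4) + (4 * n + 8)
  regroup₁ = solve-∀
  regroup₂ : ∀ m s n → m * m + m * s + 2 * n + (4 * n + 8) ≡ m * (m + s) + 2 * n + (4 * n + 8)
  regroup₂ = solve-∀
  regroup₃ : ∀ m n → m * (n + 2) + 2 * n + (4 * n + 8) ≡ (m + 4) * (n + 2) + 2 * n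
  regroup₃ = solve-∀
  regroup₄ : ∀ n → n * (n + 2) + 2 * n ≡ n * n + 4 * n
  regroup₄ = solve-∀

tail-sum≡3 : ∀ {n m q} s → 9 ≤ n → 2 ≤ s → s ≤ 5 → q ≤ s * s → m + s ≡ n + 2 →
             m * m + q + 2 * n ≡ n * n + 4 → m + 1 ≡ n × s ≡ 3 × q ≡ 3
tail-sum≡3 1 _ (s≤s ()) _ _ _ _
tail-sum≡3 {n} {m} {q} 2 n≥9 _ _ _ sumEq sqEq with +-cancelʳ-≡ 2 n m (sym sumEq)
... | refl = contradiction (begin-strict
  4         <⟨ m≤m+n 5 13 ⟩
  2 * 9     ≤⟨ *-monoʳ-≤ 2 n≥9 ⟩
  2 * n     ≤⟨ m≤n+m (2 * n) q ⟩
  q + 2 * n ≡⟨ +-cancelˡ-≡ (n * n) (q + 2 * n) 4 (trans (sym (+-assoc (n * n) q (2 * n))) sqEq) ⟩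
  4         ∎) (<-irrefl refl)
  where open ≤-Reasoning
tail-sum≡3 {n} {m} {q} 3 _ _ _ _ sumEq sqEq with m+[2+u]≡n+2⇒n≡m+u m 1 n sumEq
... | refl = refl , refl , tail-sumSq-formula m 0 q sqEq
tail-sum≡3 {n} {m} {q} 4 n≥9 _ _ q≤16 sumEq sqEq with m+[2+u]≡n+2⇒n≡m+u m 2 n sumEq
... | refl = contradiction q≤16 (<⇒≱ (begin-strict
  16                    <⟨ m≤m+n 17 1 ⟩
  2 * 7 + 1 * 1 + 3     ≤⟨ +-monoˡ-≤ 3 (+-monoˡ-≤ 1 (*-monoʳ-≤ 2 (+-cancelʳ-≤ 2 7 m n≥9))) ⟩
  2 * 1 * m + 1 * 1 + 3 ≡⟨ sym (tail-sumSq-formula m 1 q sqEq) ⟩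
  q                     ∎))
  where open ≤-Reasoning
tail-sum≡3 {n} {m} {q} 5 n≥9 _ _ q≤25 sumEq sqEq with m+[2+u]≡n+2⇒n≡m+u m 3 n sumEq
... | refl = contradiction q≤25 (<⇒≱ (begin-strict
  25                    <⟨ m≤m+n 26 5 ⟩
  2 * 2 * 6 + 2 * 2 + 3 ≤⟨ +-monoˡ-≤ 3 (+-monoˡ-≤ 4 (*-monoʳ-≤ 4 (+-cancelʳ-≤ 3 6 m n≥9))) ⟩
  2 * 2 * m + 2 * 2 + 3 ≡⟨ sym (tail-sumSq-formula m 2 q sqEq) ⟩
  q                     ∎))
  where open ≤-Reasoning
tail-sum≡3 (suc (suc (suc (suc (suc (suc _)))))) _ _ (s≤s (s≤s (s≤s (s≤s (s≤s ()))))) _ _ _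

dominant-deficiency : ∀ {n m ys} → 9 ≤ n → m ≤ n → All (_≤ m) ys → m + sum ys ≡ n + 2 →
  m * m + sumSq ys + 2 * n ≡ n * n + 4 → m + 1 ≡ n × sum ys ≡ 3 × sumSq ys ≡ 3
dominant-deficiency {n} {m} {ys} n≥9 m≤n ys≤m sumEq sqEq =
  tail-sum≡3 (sum ys) n≥9 2≤s (tail-sum≤5 sumEq sqEq (sumSq≤*sum ys≤m)) (sumSq≤sum*sum ys) sumEq sqEq
  where
  2≤s : 2 ≤ sum ys
  2≤s = +-cancelˡ-≤ n 2 (sum ys) (≤-trans (≤-reflexive (sym sumEq)) (+-monoˡ-≤ (sum ys) m≤n))

↭-maximum-first : ∀ x xs → ∃₂ λ m ys → x ∷ xs ↭ m ∷ ys × All (_≤ m) ys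
↭-maximum-first x []       = x , [] , ↭-refl , []
↭-maximum-first x (y ∷ xs) with ↭-maximum-first y xs
... | m , ys , p , ys≤m with ≤-total x m
...   | inj₁ x≤m = m , x ∷ ys , ↭-trans (prep x p) (swap x m ↭-refl) , x≤m ∷ ys≤m
...   | inj₂ m≤x = x , m ∷ ys , prep x p , m≤x ∷ All.map (λ y≤m → ≤-trans y≤m m≤x) ys≤m

max-first-profile : ∀ {n m ys} → 9 ≤ n → m ≤ n → All (_≤ m) ys → length ys ≡ 3 → m + sum ys ≡ n + 2 →
  m * m + sumSq ys + 2 * n ≡ n * n + 4 → m ∷ ys ↭ 1 ∷ 1 ∷ 1 ∷ n ∸ 1 ∷ []
max-first-profile {n} {m} {ys} n≥9 m≤n ys≤m len≡3 sumEq sqEq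
  with m+1≡n , s≡3 , q≡3 ← dominant-deficiency n≥9 m≤n ys≤m sumEq sqEq
  with refl ← trans (sym (m+n∸n≡m m 1)) (cong (_∸ 1) m+1≡n)
  with refl ← trans (All-≡⇒≡replicate (2*sum≡sumSq+length⇒All≡1 ys (trans (cong (2 *_) s≡3) (sym (cong₂ _+_ q≡3 len≡3))))) (cong (λ l → replicate l 1) len≡3)
  = ↭-sym (shift (n ∸ 1) (1 ∷ 1 ∷ 1 ∷ []) [])

deficiency-profile : ∀ {n} es → 9 ≤ n → length es ≡ 4 → All (_≤ n) es → sum es ≡ n + 2 →
  sumSq es + 2 * n ≡ n * n + 4 → es ↭ 1 ∷ 1 ∷ 1 ∷ n ∸ 1 ∷ []
deficiency-profile {n} (e ∷ es) n≥9 len≡4 es≤n sumEq sqEq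
  with m , ys , p , ys≤m ← ↭-maximum-first e es
  with m≤n ∷ _ ← All-resp-↭ p es≤n
  = ↭-trans p (max-first-profile n≥9 m≤n ys≤m (suc-injective (trans (sym (↭-length p)) len≡4))
      (trans (sym (sum-↭ p)) sumEq) (trans (cong (_+ 2 * n) (sym (sum-↭ (map⁺ (λ x → x * x) p)))) sqEq))

complement-involutive : ∀ {n xs} → All (_≤ n) xs → map (n ∸_) (map (n ∸_) xs) ≡ xs
complement-involutive {n} {xs} xs≤n =
  trans (sym (map-∘ xs)) (map-id-local (All.map m∸[m∸n]≡n xs≤n))

complement-sum : ∀ {n rs} → All (_≤ n) rs → length rs ≡ 4 → sum rs + 2 ≡ 3 * n →
  sum (map (n ∸_) rs) ≡ n + 2
complement-sum {n} {rs} rs≤n len≡4 sumEq = +-cancelˡ-≡ (sum rs + 2) (sum es) (n + 2) (begin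
  sum rs + 2 + sum es    ≡⟨ regroup₁ (sum rs) (sum es) ⟩
  sum rs + sum es + 2    ≡⟨ cong (_+ 2) (trans (sum-complement rs≤n) (cong (_* n) len≡4)) ⟩
  4 * n + 2              ≡⟨ regroup₂ n ⟩
  3 * n + (n + 2)        ≡⟨ cong (_+ (n + 2)) sumEq ⟨
  sum rs + 2 + (n + 2)   ∎)
  where
  open ≡-Reasoning
  es = map (n ∸_) rs
  regroup₁ : ∀ a b → a + 2 + b ≡ a + b + 2
  regroup₁ = solve-∀
  regroup₂ : ∀ n → 4 * n + 2 ≡ 3 * n + (n + 2)
  regroup₂ = solve-∀

complement-sumSq : ∀ {n rs} → All (_≤ n) rs → sum rs + 2 ≡ 3 * n → sum (map (n ∸_) rs) ≡ n + 2 →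
  sumSq rs + 6 * n ≡ 3 * (n * n) + 4 → sumSq (map (n ∸_) rs) + 2 * n ≡ n * n + 4
complement-sumSq {n} {rs} rs≤n sumEq es-sum sqEq =
  +-cancelʳ-≡ (n * (3 * n) + 6 * n) (sumSq es + 2 * n) (n * n + 4) (begin
    sumSq es + 2 * n + (n * (3 * n) + 6 * n)          ≡⟨ cong (λ t → sumSq es + 2 * n + (n * t + 6 * n)) sumEq ⟨
    sumSq es + 2 * n + (n * (sum rs + 2) + 6 * n)     ≡⟨ regroup₁ (sumSq es) n (sum rs) ⟩
    sumSq es + n * sum rs + 10 * n                    ≡⟨ cong (_+ 10 * n) (sumSq-complement rs≤n) ⟩
    n * sum es + sumSq rs + 10 * n                    ≡⟨ cong (λ t → n * t + sumSq rs + 10 * n) es-sum ⟩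
    n * (n + 2) + sumSq rs + 10 * n                   ≡⟨ regroup₂ n (sumSq rs) ⟩
    n * (n + 2) + 4 * n + (sumSq rs + 6 * n)          ≡⟨ cong (n * (n + 2) + 4 * n +_) sqEq ⟩
    n * (n + 2) + 4 * n + (3 * (n * n) + 4)           ≡⟨ regroup₃ n ⟩
    n * n + 4 + (n * (3 * n) + 6 * n)                 ∎)
  where
  open ≡-Reasoning
  es = map (n ∸_) rs
  regroup₁ : ∀ a n r → a + 2 * n + (n * (r + 2) + 6 * n) ≡ a + n * r + 10 * n
  regroup₁ = solve-∀
  regroup₂ : ∀ n b → n * (n + 2) + b + 10 * n ≡ n * (n + 2) + 4 * n + (b + 6 * n)
  regroup₂ = solve-∀
  regroup₃ : ∀ n → n * (n + 2) + 4 * n + (3 * (n * n) + 4) ≡ n * n + 4 + (n * (3 * n) + 6 * n)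
  regroup₃ = solve-∀

row-profile : ∀ {n} rs → 9 ≤ n → length rs ≡ 4 → All (_≤ n) rs → sum rs + 2 ≡ 3 * n →
  sumSq rs + 6 * n ≡ 3 * (n * n) + 4 → rs ↭ n ∸ 1 ∷ n ∸ 1 ∷ n ∸ 1 ∷ 1 ∷ []
row-profile {n} rs n≥9 len≡4 rs≤n sumEq sqEq =
  subst₂ _↭_ (complement-involutive rs≤n) (cong (λ a → n ∸ 1 ∷ n ∸ 1 ∷ n ∸ 1 ∷ a ∷ []) (m∸[m∸n]≡n 1≤n))
    (map⁺ (n ∸_) (deficiency-profile (map (n ∸_) rs) n≥9 (trans (length-map (n ∸_) rs) len≡4) es≤n
      es-sum (complement-sumSq rs≤n sumEq es-sum sqEq)))
  where
  1≤n : 1 ≤ n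
  1≤n = ≤-trans (s≤s z≤n) n≥9
  es≤n : All (_≤ n) (map (n ∸_) rs)
  es≤n = All.map⁺ (All.map (λ {r} _ → m∸n≤m n r) rs≤n)
  es-sum : sum (map (n ∸_) rs) ≡ n + 2
  es-sum = complement-sum rs≤n len≡4 sumEq

row-sumSq-equation : ∀ {n k λ₁ q} → k + 2 ≡ 3 * n → λ₁ + 6 ≡ 3 * n → q + λ₁ ≡ n * λ₁ + k →
  q + 6 * n ≡ 3 * (n * n) + 4
row-sumSq-equation {n} {k} {λ₁} {q} hk hλ eq = +-cancelʳ-≡ (λ₁ + 6) (q + 6 * n) (3 * (n * n) + 4) (begin
  q + 6 * n + (λ₁ + 6)              ≡⟨ regroup₁ q n λ₁ ⟩
  q + λ₁ + 6 * n + 6                ≡⟨ cong (λ t → t + 6 * n + 6) eq ⟩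
  n * λ₁ + k + 6 * n + 6            ≡⟨ regroup₂ n λ₁ k ⟩
  n * (λ₁ + 6) + (k + 2) + 4        ≡⟨ cong₂ (λ s t → n * s + t + 4) hλ hk ⟩
  n * (3 * n) + 3 * n + 4           ≡⟨ regroup₃ n ⟩
  3 * (n * n) + 4 + 3 * n           ≡⟨ cong (3 * (n * n) + 4 +_) hλ ⟨
  3 * (n * n) + 4 + (λ₁ + 6)        ∎)
  where
  open ≡-Reasoning
  regroup₁ : ∀ q n l → q + 6 * n + (l + 6) ≡ q + l + 6 * n + 6
  regroup₁ = solve-∀
  regroup₂ : ∀ n l k → n * l + k + 6 * n + 6 ≡ n * (l + 6) + (k + 2) + 4
  regroup₂ = solve-∀
  regroup₃ : ∀ n → n * (3 * n) + 3 * n + 4 ≡ 3 * (n * n) + 4 + 3 * n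
  regroup₃ = solve-∀

quotientRow-profile : ∀ {v} n → n > 8 → (G : SimpleGraph v) (cls : Fin v → Fin 4) →
  IsDDG G (3 * n ∸ 2) (3 * n ∸ 6) (2 * n ∸ 2) 4 n cls →
  (R : Fin 4 → Fin 4 → ℕ) → IsQuotientMatrix G cls R →
  ∀ x → tabulate (R (cls x)) ↭ n ∸ 1 ∷ n ∸ 1 ∷ n ∸ 1 ∷ 1 ∷ []
quotientRow-profile n n>8 G cls ddg R isQuotient x =
  row-profile (tabulate (R (cls x))) n>8 refl (All.tabulate⁺ (quotient≤classSize x))
    (trans (cong (_+ 2) (quotientRow-sum x)) (m∸n+n≡m 2≤3n))
    (row-sumSq-equation {n = n} {q = sumSq (tabulate (R (cls x)))} (m∸n+n≡m 2≤3n) (m∸n+n≡m 6≤3n)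
      (quotientRow-sumSq {{>-nonZero n>0}} x))
  where
  open Quotient.DivisibleDesign G cls R isQuotient ddg
  n>0 : n > 0
  n>0 = ≤-trans (s≤s z≤n) n>8
  6≤3n : 6 ≤ 3 * n
  6≤3n = *-monoʳ-≤ 3 (≤-trans (s≤s (s≤s z≤n)) n>8)
  2≤3n : 2 ≤ 3 * n
  2≤3n = ≤-trans (s≤s (s≤s z≤n)) 6≤3n

proposition6 : (n : ℕ) → n > 8 →
    (G : SimpleGraph (4 * n)) (cls : Fin (4 * n) → Fin 4) →
    IsDDG G (3 * n ∸ 2) (3 * n ∸ 6) (2 * n ∸ 2) 4 n cls →
    (R : Fin 4 → Fin 4 → ℕ) → IsQuotientMatrix G cls R →
    (i : Fin 4) →
    (R i zero ∷ R i (suc zero) ∷ R i (suc (suc zero)) ∷ R i (suc (suc (suc zero))) ∷ [])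
      ↭ (n ∸ 1 ∷ n ∸ 1 ∷ n ∸ 1 ∷ 1 ∷ [])
proposition6 n n>8 G cls ddg R isQuotient i
  with x , x∈i ← count>0⇒∃ (λ z → ⌊ cls z ≟ i ⌋) (subst (0 <_) (sym (IsDDG.classSize ddg i)) (≤-trans (s≤s z≤n) n>8))
  with refl ← toWitness x∈i
  = quotientRow-profile n n>8 G cls ddg R isQuotient x
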